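{- Let $\mathcal{C}(\widetilde{D}_8)$ be the point-line incidence structure with points $0,\dots,8$ and lines $\{0,2\},\{1,2\},\{2,3\},\{3,4\},\{4,5\},\{5,6\},\{6,7\},\{6,8\}$. Label its points by elements of $\overline{\mathcal{P}}_3$ via $0\mapsto XII$, $1\mapsto ZII$, $2\mapsto YII$, $3\mapsto IXI$, $4\mapsto IYI$, $5\mapsto IZI$, $6\mapsto IIY$, $7\mapsto IIX$, $8\mapsto IIZ$, and label each geometric hyperplane by the product of the labels of its points. Then: (i) the labeling is a bijection between the $63$ hyperplanes containing $\{2,4,6\}$ (which form a $\mathrm{PG}(5,2)$) and the $63$ non-identity elements of $\overline{\mathcal{P}}_3$, and the labels on each three-point Veldkamp line multiply to $III$; (ii) the $15$ hyperplanes containing $\{2,3,4,5,6\}$ (forming a $\mathrm{PG}(3,2)$) are thereby bijectively labeled by the $15$ non-identity elements of the two-qubit subgroup $\{A\,I\,B : A,B\in\{I,X,Y,Z\}\}$ of $\overline{\mathcal{P}}_3$, the pairwise commuting triples on three-point Veldkamp lines among them form a copy of $W(3,2)$, and removing the six elements on the two lines $\{XII,YII,ZII\}$ and $\{IIX,IIY,IIZ\}$ leaves nine elements forming a (three-qubit) Mermin–Peres magic square; (iii) the $7$ hyperplanes containing $\{0,1,3,5,7,8\}$, among them $\{0,1,3,5,7,8\}$ and $\{0,1,3,4,5,7,8\}$, form a Fano plane whose points are labeled by exactly the seven non-identity elements of $\{I,Y\}^{\otimes 3}$, i.e. by labels in which neither $X$ nor $Z$ occurs.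
   Context: A geometric hyperplane is a proper subset $H$ of the point set such that every line is either contained in $H$ or meets $H$ in exactly one point. A three-point Veldkamp line is a set $\{H_1,H_2,H_3\}$ of three distinct geometric hyperplanes with $H_3$ the complement of $H_1\triangle H_2$. A set $S$ of hyperplanes "forms $\mathrm{PG}(d,2)$" if $S$ together with all three-point Veldkamp lines contained in $S$ is isomorphic to the $d$-dimensional projective space over $\mathrm{GF}(2)$; a Fano plane is $\mathrm{PG}(2,2)$. $\overline{\mathcal{P}}_N$ is the $N$-qubit Pauli group modulo its center $\{\pm I^{\otimes N},\pm iI^{\otimes N}\}$, elements written as words $A_1\cdots A_N$ ($A_k\in\{I,X,Y,Z\}$) and multiplied ignoring phases; commutation is that of representing matrices. $W(3,2)$ is the symplectic polar space of rank $2$ over $\mathrm{GF}(2)$. A Mermin–Peres magic square is a $3\times3$ grid ($9$ points, $6$ lines of size three in two parallel classes of three) of elements in which each line consists of pairwise commuting elements lying on a three-point Veldkamp line. -}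

module Defs where

open import Data.Bool using (Bool; true; false; _∧_; _xor_; if_then_else_; not)
open import Data.Nat using (ℕ; suc)
open import Data.Fin using (Fin; zero; suc)
open import Data.Fin.Subset using (Subset; _∈_; _∉_; _⊆_; _∩_; _∪_; ⁅_⁆; ∣_∣; ∁)
open import Data.Vec using (Vec; []; _∷_; replicate; zipWith; foldr; lookup; allFin)
open import Data.List using (List; []; _∷_)
open import Data.List.Relation.Unary.All as LAll using ()
open import Data.Vec.Relation.Unary.All as VAll using ()
open import Data.Product using (_×_; Σ; ∃; _,_)
open import Data.Sum using (_⊎_)
open import Relation.Binary.PropositionalEquality using (_≡_; _≢_)
open import Function.Bundles using (_⇔_)

-- Single-qubit Pauli operators modulo phases (Klein four-group)

data Pauli : Set where
  I X Y Z : Pauli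

_·ₚ_ : Pauli → Pauli → Pauli
I ·ₚ b = b
a ·ₚ I = a
X ·ₚ X = I
X ·ₚ Y = Z
X ·ₚ Z = Y
Y ·ₚ X = Z
Y ·ₚ Y = I
Y ·ₚ Z = X
Z ·ₚ X = Y
Z ·ₚ Y = X
Z ·ₚ Z = I

anti₁ : Pauli → Pauli → Bool
anti₁ I _ = false
anti₁ _ I = false
anti₁ X X = false
anti₁ Y Y = false
anti₁ Z Z = false
anti₁ _ _ = true

-- Three-qubit Pauli group modulo its centre: words A₁A₂A₃

P3 : Set
P3 = Vec Pauli 3

_·_ : P3 → P3 → P3
_·_ = zipWith _·ₚ_

III : P3
III = I ∷ I ∷ I ∷ []

antiParity : ∀ {n} → Vec Pauli n → Vec Pauli n → Bool
antiParity [] [] = false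
antiParity (a ∷ as) (b ∷ bs) = anti₁ a b xor antiParity as bs

Commute : P3 → P3 → Set
Commute g h = antiParity g h ≡ false

Point : Set
Point = Fin 9

Pts : Set
Pts = Subset 9

p0 p1 p2 p3 p4 p5 p6 p7 p8 : Point
p0 = zero
p1 = suc zero
p2 = suc (suc zero)
p3 = suc (suc (suc zero))
p4 = suc (suc (suc (suc zero)))
p5 = suc (suc (suc (suc (suc zero))))
p6 = suc (suc (suc (suc (suc (suc zero)))))
p7 = suc (suc (suc (suc (suc (suc (suc zero))))))
p8 = suc (suc (suc (suc (suc (suc (suc (suc zero)))))))

pair : Point → Point → Pts
pair a b = ⁅ a ⁆ ∪ ⁅ b ⁆

lines : List Pts
lines = pair p0 p2 ∷ pair p1 p2 ∷ pair p2 p3 ∷ pair p3 p4 ∷ pair p4 p5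
      ∷ pair p5 p6 ∷ pair p6 p7 ∷ pair p6 p8 ∷ []

fullSet : Pts
fullSet = replicate 9 true

IsHyperplane : Pts → Set
IsHyperplane H = (H ≢ fullSet) × LAll.All (λ L → (L ⊆ H) ⊎ (∣ L ∩ H ∣ ≡ 1)) lines

_△_ : ∀ {n} → Subset n → Subset n → Subset n
_△_ = zipWith _xor_

VeldkampLine : Pts → Pts → Pts → Set
VeldkampLine H₁ H₂ H₃ =
  IsHyperplane H₁ × IsHyperplane H₂ × IsHyperplane H₃ ×
  H₁ ≢ H₂ × H₁ ≢ H₃ × H₂ ≢ H₃ × H₃ ≡ ∁ (H₁ △ H₂)

XII ZII YII IXI IYI IZI IIY IIX IIZ : P3
XII = X ∷ I ∷ I ∷ []
ZII = Z ∷ I ∷ I ∷ []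
YII = Y ∷ I ∷ I ∷ []
IXI = I ∷ X ∷ I ∷ []
IYI = I ∷ Y ∷ I ∷ []
IZI = I ∷ Z ∷ I ∷ []
IIY = I ∷ I ∷ Y ∷ []
IIX = I ∷ I ∷ X ∷ []
IIZ = I ∷ I ∷ Z ∷ []

pointLabels : Vec P3 9
pointLabels = XII ∷ ZII ∷ YII ∷ IXI ∷ IYI ∷ IZI ∷ IIY ∷ IIX ∷ IIZ ∷ []

pointLabel : Point → P3
pointLabel i = lookup pointLabels i

label : Pts → P3
label H = foldr (λ _ → P3) _·_ III (zipWith (λ b g → if b then g else III) H pointLabels)

BVec : ℕ → Set
BVec n = Vec Bool n

NonZero : ∀ {n} → BVec n → Set
NonZero {n} v = v ≢ replicate n false

PGLine : ∀ {n} → BVec n → BVec n → BVec n → Set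
PGLine u v w = u ≢ v × u ≢ w × v ≢ w × w ≡ zipWith _xor_ u v

IsoTo : (n : ℕ) → (BVec n → BVec n → BVec n → Set) → (Pts → Set)
      → (Pts → Pts → Pts → Set) → Set
IsoTo n Line S VLine =
  Σ (BVec n → Pts) λ f →
    (∀ v → NonZero v → S (f v)) ×
    (∀ v w → NonZero v → NonZero w → f v ≡ f w → v ≡ w) ×
    (∀ H → S H → ∃ λ v → NonZero v × f v ≡ H) ×
    (∀ u v w → NonZero u → NonZero v → NonZero w →
       Line u v w ⇔ VLine (f u) (f v) (f w))

FormsPG : ℕ → (Pts → Set) → Set
FormsPG d S = IsoTo (suc d) PGLine S VeldkampLine

-- W(3,2): points of PG(3,2), lines = totally isotropic lines of the
-- standard symplectic form on GF(2)^4
symp : BVec 4 → BVec 4 → Bool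
symp (a₁ ∷ a₂ ∷ a₃ ∷ a₄ ∷ []) (b₁ ∷ b₂ ∷ b₃ ∷ b₄ ∷ []) =
  (a₁ ∧ b₂) xor (a₂ ∧ b₁) xor (a₃ ∧ b₄) xor (a₄ ∧ b₃)

W32Line : BVec 4 → BVec 4 → BVec 4 → Set
W32Line u v w = PGLine u v w × symp u v ≡ false

CommutingVeldkampLine : Pts → Pts → Pts → Set
CommutingVeldkampLine H₁ H₂ H₃ =
  VeldkampLine H₁ H₂ H₃ ×
  Commute (label H₁) (label H₂) × Commute (label H₁) (label H₃) ×
  Commute (label H₂) (label H₃)

LabelBijection : (Pts → Set) → (P3 → Set) → Set
LabelBijection S E =
  (∀ H → S H → E (label H)) ×
  (∀ H H' → S H → S H' → label H ≡ label H' → H ≡ H') ×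
  (∀ g → E g → ∃ λ H → S H × label H ≡ g)

HypContaining : List Point → Pts → Set
HypContaining ps H = IsHyperplane H × LAll.All (λ p → p ∈ H) ps

S₁ S₂ S₃ : Pts → Set
S₁ = HypContaining (p2 ∷ p4 ∷ p6 ∷ [])
S₂ = HypContaining (p2 ∷ p3 ∷ p4 ∷ p5 ∷ p6 ∷ [])
S₃ = HypContaining (p0 ∷ p1 ∷ p3 ∷ p5 ∷ p7 ∷ p8 ∷ [])

setOf : List Point → Pts
setOf [] = replicate 9 false
setOf (p ∷ ps) = ⁅ p ⁆ ∪ setOf ps

NonId : P3 → Set
NonId g = g ≢ III

TwoQubit : P3 → Set
TwoQubit g = lookup g (suc zero) ≡ I

OnlyIY : P3 → Set
OnlyIY g = VAll.All (λ a → (a ≡ I) ⊎ (a ≡ Y)) g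

Removed : P3 → Set
Removed g = (g ≡ XII) ⊎ (g ≡ YII) ⊎ (g ≡ ZII) ⊎ (g ≡ IIX) ⊎ (g ≡ IIY) ⊎ (g ≡ IIZ)

MagicSquare : (Pts → Set) → (P3 → Set) → Set
MagicSquare S E =
  Σ (Fin 3 → Fin 3 → Pts) λ m →
    (∀ i j → S (m i j)) ×
    (∀ i j → E (label (m i j))) ×
    (∀ i j k l → label (m i j) ≡ label (m k l) → (i ≡ k) × (j ≡ l)) ×
    (∀ g → E g → ∃ λ i → ∃ λ j → label (m i j) ≡ g) ×
    (∀ i → CommutingVeldkampLine (m i zero) (m i (suc zero)) (m i (suc (suc zero)))) ×
    (∀ j → CommutingVeldkampLine (m zero j) (m (suc zero) j) (m (suc (suc zero)) j))

module Submission where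

open import Defs
open import Data.Product using (_×_)
open import Relation.Binary.PropositionalEquality using (_≡_)
open import Relation.Nullary using (¬_)
open import Data.List using (_∷_; [])

open import Algebra.Definitions using (Associative; Commutative)
open import Data.Bool using (Bool; true; false; not; _xor_; if_then_else_)
import Data.Bool.Properties as Bool
open import Data.Fin using (Fin; zero; suc)
import Data.Fin.Properties as Fin
open import Data.Fin.Subset using (Subset; _∩_; ∣_∣; ∁)
open import Data.Fin.Subset.Properties using (_∈?_; _⊆?_)
open import Data.List using (List)
import Data.List.Relation.Unary.All as ListAll
open import Data.Nat using (zero; suc)
import Data.Nat.Properties as ℕ
open import Data.Product using (∃; _,_; proj₁; proj₂)
import Data.Product.Properties as Product
open import Data.Sum using (_⊎_; inj₁; inj₂)
open import Data.Vec using (Vec; []; _∷_; replicate; zipWith; foldr; lookup)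
import Data.Vec.Properties as Vec
open import Data.Vec.Relation.Binary.Pointwise.Inductive
  using (Pointwise-≡⇒≡; zipWith-assoc; zipWith-comm)
open import Data.Vec.Relation.Unary.All using ([]; _∷_)
open import Function.Base using (_∘_)
open import Function.Bundles using (_⇔_; mk⇔; Equivalence)
open import Level using (0ℓ)
open import Relation.Binary.Definitions using (DecidableEquality)
open import Relation.Binary.PropositionalEquality
  using (refl; sym; trans; cong; cong₂; subst; module ≡-Reasoning)
open import Relation.Nullary.Decidable
  using (Dec; map′; from-yes; ¬?; _×-dec_; _⊎-dec_; _→-dec_)
open import Relation.Unary using (Pred; Decidable)

-- Every line of C(D̃₈) has two points, so H is a geometric hyperplane iff its complement is a
-- nonempty set of pairwise non-collinear points, and H₃ = ∁ (H₁ △ H₂) says that the complements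
-- add up in GF(2)⁹. Each of the three families consists of the complements of the nonempty
-- subsets of a fixed set of pairwise non-collinear points ({0,1,3,5,7,8}, {0,1,7,8} and {2,4,6}),
-- so it is coordinatised by the nonzero vectors of GF(2)ⁿ, Veldkamp lines becoming the lines
-- {u, v, u + v} of PG(n-1,2).
-- Since the nine point labels multiply to III and P̄₃ is an elementary abelian 2-group, labelling
-- turns △ into multiplication: a hyperplane carries the label of its complement, and the labels
-- on every Veldkamp line multiply to III. In coordinates the labelling is the symplectic (x|z)
-- encoding of Pauli words, which turns commutation into the symplectic form and so yields W(3,2).
-- The remaining finite facts about the concrete maps are verified by exhaustive search.

Searchable : Set → Set₁
Searchable A = ∀ {P : Pred A 0ℓ} → Decidable P → Dec (∀ a → P a)

bool-searchable : Searchable Bool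
bool-searchable P? =
  map′ (λ (t , f) → λ { true → t ; false → f }) (λ h → h true , h false) (P? true ×-dec P? false)

pauli-searchable : Searchable Pauli
pauli-searchable P? =
  map′ (λ (i , x , y , z) → λ { I → i ; X → x ; Y → y ; Z → z }) (λ h → h I , h X , h Y , h Z)
    (P? I ×-dec P? X ×-dec P? Y ×-dec P? Z)

vec-searchable : ∀ {A n} → Searchable A → Searchable (Vec A n)
vec-searchable {n = zero}  ∀? P? = map′ (λ p → λ { [] → p }) (λ h → h []) (P? [])
vec-searchable {n = suc n} ∀? P? =
  map′ (λ h → λ { (a ∷ v) → h a v }) (λ h a v → h (a ∷ v))
    (∀? λ a → vec-searchable ∀? λ v → P? (a ∷ v))

∀ᵇ? : ∀ {n} → Searchable (BVec n)
∀ᵇ? = vec-searchable bool-searchable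

∀ʷ? : ∀ {n} → Searchable (Vec Pauli n)
∀ʷ? = vec-searchable pauli-searchable

-- Pauli operators as GF(2)² and P̄₃ as GF(2)⁶

pauli : Bool → Bool → Pauli
pauli false false = I
pauli true  false = X
pauli true  true  = Y
pauli false true  = Z

xBit zBit : Pauli → Bool
xBit I = false
xBit X = true
xBit Y = true
xBit Z = false
zBit I = false
zBit X = false
zBit Y = true
zBit Z = true

pauli-bits : ∀ p → pauli (xBit p) (zBit p) ≡ p
pauli-bits I = refl
pauli-bits X = refl
pauli-bits Y = refl
pauli-bits Z = refl

_≟ₚ_ : DecidableEquality Pauli
p ≟ₚ q =
  map′ (λ e → trans (sym (pauli-bits p)) (trans (cong (λ (x , z) → pauli x z) e) (pauli-bits q)))
       (cong (λ r → xBit r , zBit r))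
       (Product.≡-dec Bool._≟_ Bool._≟_ (xBit p , zBit p) (xBit q , zBit q))

_≟ʷ_ : ∀ {n} → DecidableEquality (Vec Pauli n)
_≟ʷ_ = Vec.≡-dec _≟ₚ_

_≟ˢ_ : ∀ {n} → DecidableEquality (Subset n)
_≟ˢ_ = Vec.≡-dec Bool._≟_

·ₚ-assoc : Associative _≡_ _·ₚ_
·ₚ-assoc = from-yes (pauli-searchable λ a → pauli-searchable λ b → pauli-searchable λ c →
  ((a ·ₚ b) ·ₚ c) ≟ₚ (a ·ₚ (b ·ₚ c)))

·ₚ-comm : Commutative _≡_ _·ₚ_
·ₚ-comm = from-yes (pauli-searchable λ a → pauli-searchable λ b → (a ·ₚ b) ≟ₚ (b ·ₚ a))

·ₚ-inverse : ∀ a → a ·ₚ a ≡ I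
·ₚ-inverse I = refl
·ₚ-inverse X = refl
·ₚ-inverse Y = refl
·ₚ-inverse Z = refl

·-assoc : Associative _≡_ _·_
·-assoc g h k = Pointwise-≡⇒≡ (zipWith-assoc ·ₚ-assoc g h k)

·-comm : Commutative _≡_ _·_
·-comm g h = Pointwise-≡⇒≡ (zipWith-comm ·ₚ-comm g h)

·-identityˡ : ∀ g → III · g ≡ g
·-identityˡ (a ∷ b ∷ c ∷ []) = refl

·-identityʳ : ∀ g → g · III ≡ g
·-identityʳ g = trans (·-comm g III) (·-identityˡ g)

·-inverse : ∀ g → g · g ≡ III
·-inverse (a ∷ b ∷ c ∷ []) rewrite ·ₚ-inverse a | ·ₚ-inverse b | ·ₚ-inverse c = refl

·-interchange : ∀ w x y z → (w · x) · (y · z) ≡ (w · y) · (x · z)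
·-interchange w x y z = begin
  (w · x) · (y · z)  ≡⟨ ·-assoc w x (y · z) ⟩
  w · (x · (y · z))  ≡⟨ cong (w ·_) (sym (·-assoc x y z)) ⟩
  w · ((x · y) · z)  ≡⟨ cong (λ t → w · (t · z)) (·-comm x y) ⟩
  w · ((y · x) · z)  ≡⟨ cong (w ·_) (·-assoc y x z) ⟩
  w · (y · (x · z))  ≡⟨ sym (·-assoc w y (x · z)) ⟩
  (w · y) · (x · z)  ∎
  where open ≡-Reasoning

labelWith : ∀ {n} → Vec P3 n → Subset n → P3
labelWith ls A = foldr (λ _ → P3) _·_ III (zipWith (λ b g → if b then g else III) A ls)

select-xor : ∀ a b g →
  (if a xor b then g else III) ≡ (if a then g else III) · (if b then g else III)
select-xor false false g = refl
select-xor false true  g = sym (·-identityˡ g)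
select-xor true  false g = sym (·-identityʳ g)
select-xor true  true  g = sym (·-inverse g)

labelWith-△ : ∀ {n} (ls : Vec P3 n) A B →
              labelWith ls (A △ B) ≡ labelWith ls A · labelWith ls B
labelWith-△ []       []      []      = refl
labelWith-△ (g ∷ ls) (a ∷ A) (b ∷ B) =
  trans (cong₂ _·_ (select-xor a b g) (labelWith-△ ls A B)) (·-interchange _ _ _ _)

label-fullSet : label fullSet ≡ III
label-fullSet = refl

∁-as-△ : ∀ {n} (A : Subset n) → ∁ A ≡ A △ replicate n true
∁-as-△ []      = refl
∁-as-△ (a ∷ A) = cong₂ _∷_ (trans (sym (Bool.true-xor a)) (Bool.xor-comm true a)) (∁-as-△ A)

label-∁ : ∀ A → label (∁ A) ≡ label A
label-∁ A = begin
  label (∁ A)              ≡⟨ cong label (∁-as-△ A) ⟩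
  label (A △ fullSet)      ≡⟨ labelWith-△ pointLabels A fullSet ⟩
  label A · label fullSet  ≡⟨ cong (label A ·_) label-fullSet ⟩
  label A · III            ≡⟨ ·-identityʳ (label A) ⟩
  label A                  ∎
  where open ≡-Reasoning

veldkampLine-label-product : ∀ {H₁ H₂ H₃} → VeldkampLine H₁ H₂ H₃ →
                             (label H₁ · label H₂) · label H₃ ≡ III
veldkampLine-label-product {H₁} {H₂} (_ , _ , _ , _ , _ , _ , refl) = begin
  (label H₁ · label H₂) · label (∁ (H₁ △ H₂))  ≡⟨ cong ((label H₁ · label H₂) ·_) (label-∁ (H₁ △ H₂)) ⟩
  (label H₁ · label H₂) · label (H₁ △ H₂)      ≡⟨ cong ((label H₁ · label H₂) ·_) (labelWith-△ pointLabels H₁ H₂) ⟩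
  (label H₁ · label H₂) · (label H₁ · label H₂) ≡⟨ ·-inverse (label H₁ · label H₂) ⟩
  III                                          ∎
  where open ≡-Reasoning

isHyperplane? : Decidable IsHyperplane
isHyperplane? H =
  ¬? (H ≟ˢ fullSet) ×-dec ListAll.all? (λ L → (L ⊆? H) ⊎-dec (∣ L ∩ H ∣ ℕ.≟ 1)) lines

hypContaining? : ∀ ps → Decidable (HypContaining ps)
hypContaining? ps H = isHyperplane? H ×-dec ListAll.all? (_∈? H) ps

S₂? : Decidable S₂
S₂? = hypContaining? _

S₃? : Decidable S₃
S₃? = hypContaining? _

veldkampLine? : ∀ H₁ H₂ H₃ → Dec (VeldkampLine H₁ H₂ H₃)
veldkampLine? H₁ H₂ H₃ =
  isHyperplane? H₁ ×-dec isHyperplane? H₂ ×-dec isHyperplane? H₃ ×-dec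
  ¬? (H₁ ≟ˢ H₂) ×-dec ¬? (H₁ ≟ˢ H₃) ×-dec ¬? (H₂ ≟ˢ H₃) ×-dec (H₃ ≟ˢ ∁ (H₁ △ H₂))

commute? : ∀ g h → Dec (Commute g h)
commute? g h = antiParity g h Bool.≟ false

commutingVeldkampLine? : ∀ H₁ H₂ H₃ → Dec (CommutingVeldkampLine H₁ H₂ H₃)
commutingVeldkampLine? H₁ H₂ H₃ =
  veldkampLine? H₁ H₂ H₃ ×-dec commute? (label H₁) (label H₂) ×-dec
  commute? (label H₁) (label H₃) ×-dec commute? (label H₂) (label H₃)

zeros : ∀ {n} → BVec n
zeros = replicate _ false

_⊕_ : ∀ {n} → BVec n → BVec n → BVec n
_⊕_ = zipWith _xor_

record IsCoordinatisation {n} (ps : List Point) (point : BVec n → Pts) (coords : Pts → BVec n)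
       : Set where
  field
    coords-point : ∀ v → coords (point v) ≡ v
    point-coords : ∀ H → HypContaining ps H → point (coords H) ≡ H
    point-zeros  : point zeros ≡ fullSet
    point-⊕      : ∀ u v → point (u ⊕ v) ≡ ∁ (point u △ point v)
    point-hyp    : ∀ v → NonZero v → HypContaining ps (point v)

isCoordinatisation? : ∀ {n} ps point coords → Dec (IsCoordinatisation {n} ps point coords)
isCoordinatisation? ps point coords =
  map′ (λ (a , b , c , d , e) → record
         { coords-point = a ; point-coords = b ; point-zeros = c ; point-⊕ = d ; point-hyp = e })
       (λ r → let open IsCoordinatisation r
              in coords-point , point-coords , point-zeros , point-⊕ , point-hyp)
    (      (∀ᵇ? λ v → coords (point v) ≟ˢ v)
     ×-dec (∀ᵇ? λ H → hypContaining? ps H →-dec (point (coords H) ≟ˢ H))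
     ×-dec (point zeros ≟ˢ fullSet)
     ×-dec (∀ᵇ? λ u → ∀ᵇ? λ v → point (u ⊕ v) ≟ˢ ∁ (point u △ point v))
     ×-dec (∀ᵇ? λ v → ¬? (v ≟ˢ zeros) →-dec hypContaining? ps (point v)))

module Coordinatisation {n} {ps : List Point} {point : BVec n → Pts} {coords : Pts → BVec n}
  (isCoordinatisation : IsCoordinatisation ps point coords) where

  open IsCoordinatisation isCoordinatisation

  point-injective : ∀ u v → point u ≡ point v → u ≡ v
  point-injective u v e = trans (sym (coords-point u)) (trans (cong coords e) (coords-point v))

  coords-nonZero : ∀ H → HypContaining ps H → NonZero (coords H)
  coords-nonZero H h e =
    proj₁ (proj₁ h) (trans (sym (point-coords H h)) (trans (cong point e) point-zeros))

  point-surjective : ∀ H → HypContaining ps H → ∃ λ v → NonZero v × point v ≡ H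
  point-surjective H h = coords H , coords-nonZero H h , point-coords H h

  pgLine⇔veldkampLine : ∀ u v w → NonZero u → NonZero v → NonZero w →
                        PGLine u v w ⇔ VeldkampLine (point u) (point v) (point w)
  pgLine⇔veldkampLine u v w u≢0 v≢0 w≢0 = mk⇔ to from
    where
    to : PGLine u v w → VeldkampLine (point u) (point v) (point w)
    to (u≢v , u≢w , v≢w , refl) =
      proj₁ (point-hyp u u≢0) , proj₁ (point-hyp v v≢0) , proj₁ (point-hyp w w≢0) ,
      (λ e → u≢v (point-injective u v e)) , (λ e → u≢w (point-injective u w e)) ,
      (λ e → v≢w (point-injective v w e)) , point-⊕ u v
    from : VeldkampLine (point u) (point v) (point w) → PGLine u v w
    from (_ , _ , _ , pu≢pv , pu≢pw , pv≢pw , e) =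
      (λ e → pu≢pv (cong point e)) , (λ e → pu≢pw (cong point e)) , (λ e → pv≢pw (cong point e)) ,
      point-injective w (u ⊕ v) (trans e (sym (point-⊕ u v)))

  isoTo : ∀ Line VLine →
          (∀ u v w → NonZero u → NonZero v → NonZero w →
             Line u v w ⇔ VLine (point u) (point v) (point w)) →
          IsoTo n Line (HypContaining ps) VLine
  isoTo _ _ lines = point , point-hyp , (λ u v _ _ → point-injective u v) , point-surjective , lines

  formsPG : IsoTo n PGLine (HypContaining ps) VeldkampLine
  formsPG = isoTo PGLine VeldkampLine pgLine⇔veldkampLine

  module Labelling (encode : BVec n → P3) (decode : P3 → BVec n)
    (label-point   : ∀ v → label (point v) ≡ encode v)
    (decode-encode : ∀ v → decode (encode v) ≡ v)
    (encode-zeros  : encode zeros ≡ III) where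

    encode-nonId : ∀ v → NonZero v → NonId (encode v)
    encode-nonId v v≢0 e = v≢0 (begin
      v                      ≡⟨ sym (decode-encode v) ⟩
      decode (encode v)      ≡⟨ cong decode (trans e (sym encode-zeros)) ⟩
      decode (encode zeros)  ≡⟨ decode-encode zeros ⟩
      zeros                  ∎)
      where open ≡-Reasoning

    label-coords : ∀ H → HypContaining ps H → label H ≡ encode (coords H)
    label-coords H h = trans (cong label (sym (point-coords H h))) (label-point (coords H))

    labelBijection : (E : P3 → Set) →
                     (∀ v → NonZero v → E (encode v)) →
                     (∀ g → E g → NonId g) →
                     (∀ g → E g → encode (decode g) ≡ g) →
                     LabelBijection (HypContaining ps) E
    labelBijection E E-encode E-nonId encode-decode = E-label , label-injective , label-surjective
      where
      E-label : ∀ H → HypContaining ps H → E (label H)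
      E-label H h = subst E (sym (label-coords H h)) (E-encode (coords H) (coords-nonZero H h))

      label-injective : ∀ H H' → HypContaining ps H → HypContaining ps H' →
                        label H ≡ label H' → H ≡ H'
      label-injective H H' h h' e = begin
        H                                    ≡⟨ sym (point-coords H h) ⟩
        point (coords H)                     ≡⟨ cong point (sym (decode-encode (coords H))) ⟩
        point (decode (encode (coords H)))   ≡⟨ cong (point ∘ decode) encodings-equal ⟩
        point (decode (encode (coords H')))  ≡⟨ cong point (decode-encode (coords H')) ⟩
        point (coords H')                    ≡⟨ point-coords H' h' ⟩
        H'                                   ∎
        where
        open ≡-Reasoning
        encodings-equal : encode (coords H) ≡ encode (coords H')
        encodings-equal = trans (sym (label-coords H h)) (trans e (label-coords H' h'))

      decode-nonZero : ∀ g → E g → NonZero (decode g)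
      decode-nonZero g Eg e =
        E-nonId g Eg (trans (sym (encode-decode g Eg)) (trans (cong encode e) encode-zeros))

      label-surjective : ∀ g → E g → ∃ λ H → HypContaining ps H × label H ≡ g
      label-surjective g Eg =
        point (decode g) , point-hyp (decode g) (decode-nonZero g Eg) ,
        trans (label-point (decode g)) (encode-decode g Eg)

point₁ : BVec 6 → Pts
point₁ (a ∷ b ∷ c ∷ d ∷ e ∷ f ∷ []) = ∁ (a ∷ b ∷ false ∷ c ∷ false ∷ d ∷ false ∷ e ∷ f ∷ [])

coords₁ : Pts → BVec 6
coords₁ (h₀ ∷ h₁ ∷ _ ∷ h₃ ∷ _ ∷ h₅ ∷ _ ∷ h₇ ∷ h₈ ∷ []) =
  not h₀ ∷ not h₁ ∷ not h₃ ∷ not h₅ ∷ not h₇ ∷ not h₈ ∷ []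

encode₁ : BVec 6 → P3
encode₁ (a ∷ b ∷ c ∷ d ∷ e ∷ f ∷ []) = pauli a b ∷ pauli c d ∷ pauli e f ∷ []

decode₁ : P3 → BVec 6
decode₁ (x ∷ y ∷ z ∷ []) = xBit x ∷ zBit x ∷ xBit y ∷ zBit y ∷ xBit z ∷ zBit z ∷ []

encode₁-decode₁ : ∀ g → encode₁ (decode₁ g) ≡ g
encode₁-decode₁ (x ∷ y ∷ z ∷ []) rewrite pauli-bits x | pauli-bits y | pauli-bits z = refl

module C₁ = Coordinatisation
  (from-yes (isCoordinatisation? (p2 ∷ p4 ∷ p6 ∷ []) point₁ coords₁))

module L₁ = C₁.Labelling encode₁ decode₁
  (from-yes (∀ᵇ? λ v → label (point₁ v) ≟ʷ encode₁ v))
  (from-yes (∀ᵇ? λ v → decode₁ (encode₁ v) ≟ˢ v))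
  refl

point₂ : BVec 4 → Pts
point₂ (a ∷ b ∷ e ∷ f ∷ []) = ∁ (a ∷ b ∷ false ∷ false ∷ false ∷ false ∷ false ∷ e ∷ f ∷ [])

coords₂ : Pts → BVec 4
coords₂ (h₀ ∷ h₁ ∷ _ ∷ _ ∷ _ ∷ _ ∷ _ ∷ h₇ ∷ h₈ ∷ []) = not h₀ ∷ not h₁ ∷ not h₇ ∷ not h₈ ∷ []

encode₂ : BVec 4 → P3
encode₂ (a ∷ b ∷ e ∷ f ∷ []) = pauli a b ∷ I ∷ pauli e f ∷ []

decode₂ : P3 → BVec 4
decode₂ (x ∷ _ ∷ z ∷ []) = xBit x ∷ zBit x ∷ xBit z ∷ zBit z ∷ []

encode₂-decode₂ : ∀ g → TwoQubit g → encode₂ (decode₂ g) ≡ g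
encode₂-decode₂ (x ∷ .I ∷ z ∷ []) refl rewrite pauli-bits x | pauli-bits z = refl

twoQubit-encode₂ : ∀ v → TwoQubit (encode₂ v)
twoQubit-encode₂ (a ∷ b ∷ e ∷ f ∷ []) = refl

module C₂ = Coordinatisation
  (from-yes (isCoordinatisation? (p2 ∷ p3 ∷ p4 ∷ p5 ∷ p6 ∷ []) point₂ coords₂))

module L₂ = C₂.Labelling encode₂ decode₂
  (from-yes (∀ᵇ? λ v → label (point₂ v) ≟ʷ encode₂ v))
  (from-yes (∀ᵇ? λ v → decode₂ (encode₂ v) ≟ˢ v))
  refl

antiParity-label₂ : ∀ u v → antiParity (label (point₂ u)) (label (point₂ v)) ≡ symp u v
antiParity-label₂ = from-yes (∀ᵇ? λ u → ∀ᵇ? λ v →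
  antiParity (label (point₂ u)) (label (point₂ v)) Bool.≟ symp u v)

symp-on-line : ∀ u v → symp u (u ⊕ v) ≡ symp u v × symp v (u ⊕ v) ≡ symp u v
symp-on-line = from-yes (∀ᵇ? λ u → ∀ᵇ? λ v →
  (symp u (u ⊕ v) Bool.≟ symp u v) ×-dec (symp v (u ⊕ v) Bool.≟ symp u v))

w32Line⇔commutingVeldkampLine : ∀ u v w → NonZero u → NonZero v → NonZero w →
  W32Line u v w ⇔ CommutingVeldkampLine (point₂ u) (point₂ v) (point₂ w)
w32Line⇔commutingVeldkampLine u v w u≢0 v≢0 w≢0 = mk⇔ to from
  where
  open Equivalence (C₂.pgLine⇔veldkampLine u v w u≢0 v≢0 w≢0)
    renaming (to to pgLine⇒veldkampLine; from to veldkampLine⇒pgLine)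
  to : W32Line u v w → CommutingVeldkampLine (point₂ u) (point₂ v) (point₂ w)
  to (line@(_ , _ , _ , refl) , isotropic) =
    pgLine⇒veldkampLine line ,
    trans (antiParity-label₂ u v) isotropic ,
    trans (antiParity-label₂ u w) (trans (proj₁ (symp-on-line u v)) isotropic) ,
    trans (antiParity-label₂ v w) (trans (proj₂ (symp-on-line u v)) isotropic)
  from : CommutingVeldkampLine (point₂ u) (point₂ v) (point₂ w) → W32Line u v w
  from (line , uv-commute , _ , _) =
    veldkampLine⇒pgLine line , trans (sym (antiParity-label₂ u v)) uv-commute

squareWords : Vec (Vec P3 3) 3
squareWords =
  ((X ∷ I ∷ X ∷ []) ∷ (Y ∷ I ∷ Y ∷ []) ∷ (Z ∷ I ∷ Z ∷ []) ∷ []) ∷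
  ((Y ∷ I ∷ Z ∷ []) ∷ (Z ∷ I ∷ X ∷ []) ∷ (X ∷ I ∷ Y ∷ []) ∷ []) ∷
  ((Z ∷ I ∷ Y ∷ []) ∷ (X ∷ I ∷ Z ∷ []) ∷ (Y ∷ I ∷ X ∷ []) ∷ []) ∷ []

cell : Fin 3 → Fin 3 → Pts
cell i j = point₂ (decode₂ (lookup (lookup squareWords i) j))

removed? : Decidable Removed
removed? g =
  (g ≟ʷ XII) ⊎-dec (g ≟ʷ YII) ⊎-dec (g ≟ʷ ZII) ⊎-dec (g ≟ʷ IIX) ⊎-dec (g ≟ʷ IIY) ⊎-dec (g ≟ʷ IIZ)

SquareLabel : P3 → Set
SquareLabel g = NonId g × TwoQubit g × ¬ Removed g

squareLabel? : Decidable SquareLabel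
squareLabel? g = ¬? (g ≟ʷ III) ×-dec (lookup g (suc zero) ≟ₚ I) ×-dec ¬? (removed? g)

magicSquare : MagicSquare S₂ SquareLabel
magicSquare = cell ,
  from-yes (Fin.all? λ i → Fin.all? λ j → S₂? (cell i j)) ,
  from-yes (Fin.all? λ i → Fin.all? λ j → squareLabel? (label (cell i j))) ,
  from-yes (Fin.all? λ i → Fin.all? λ j → Fin.all? λ k → Fin.all? λ l →
    (label (cell i j) ≟ʷ label (cell k l)) →-dec ((i Fin.≟ k) ×-dec (j Fin.≟ l))) ,
  from-yes (∀ʷ? λ g → squareLabel? g →-dec
    Fin.any? λ i → Fin.any? λ j → label (cell i j) ≟ʷ g) ,
  from-yes (Fin.all? λ i →
    commutingVeldkampLine? (cell i zero) (cell i (suc zero)) (cell i (suc (suc zero)))) ,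
  from-yes (Fin.all? λ j →
    commutingVeldkampLine? (cell zero j) (cell (suc zero) j) (cell (suc (suc zero)) j))

point₃ : BVec 3 → Pts
point₃ (a ∷ b ∷ c ∷ []) = ∁ (false ∷ false ∷ a ∷ false ∷ b ∷ false ∷ c ∷ false ∷ false ∷ [])

coords₃ : Pts → BVec 3
coords₃ (_ ∷ _ ∷ h₂ ∷ _ ∷ h₄ ∷ _ ∷ h₆ ∷ _ ∷ _ ∷ []) = not h₂ ∷ not h₄ ∷ not h₆ ∷ []

encode₃ : BVec 3 → P3
encode₃ (a ∷ b ∷ c ∷ []) = pauli a a ∷ pauli b b ∷ pauli c c ∷ []

decode₃ : P3 → BVec 3
decode₃ (x ∷ y ∷ z ∷ []) = xBit x ∷ xBit y ∷ xBit z ∷ []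

IorY : Pauli → Set
IorY p = (p ≡ I) ⊎ (p ≡ Y)

pauli-diagonal : ∀ a → IorY (pauli a a)
pauli-diagonal false = inj₁ refl
pauli-diagonal true  = inj₂ refl

pauli-diagonal-xBit : ∀ {p} → IorY p → pauli (xBit p) (xBit p) ≡ p
pauli-diagonal-xBit (inj₁ refl) = refl
pauli-diagonal-xBit (inj₂ refl) = refl

onlyIY-encode₃ : ∀ v → OnlyIY (encode₃ v)
onlyIY-encode₃ (a ∷ b ∷ c ∷ []) = pauli-diagonal a ∷ pauli-diagonal b ∷ pauli-diagonal c ∷ []

encode₃-decode₃ : ∀ g → OnlyIY g → encode₃ (decode₃ g) ≡ g
encode₃-decode₃ (x ∷ y ∷ z ∷ []) (x∈IY ∷ y∈IY ∷ z∈IY ∷ [])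
  rewrite pauli-diagonal-xBit x∈IY | pauli-diagonal-xBit y∈IY | pauli-diagonal-xBit z∈IY = refl

module C₃ = Coordinatisation
  (from-yes (isCoordinatisation? (p0 ∷ p1 ∷ p3 ∷ p5 ∷ p7 ∷ p8 ∷ []) point₃ coords₃))

module L₃ = C₃.Labelling encode₃ decode₃
  (from-yes (∀ᵇ? λ v → label (point₃ v) ≟ʷ encode₃ v))
  (from-yes (∀ᵇ? λ v → decode₃ (encode₃ v) ≟ˢ v))
  refl

mainTheorem11 :
    (FormsPG 5 S₁ ×
     LabelBijection S₁ NonId ×
     (∀ H₁ H₂ H₃ → S₁ H₁ → S₁ H₂ → S₁ H₃ → VeldkampLine H₁ H₂ H₃ →
        (label H₁ · label H₂) · label H₃ ≡ III)) ×
    (FormsPG 3 S₂ ×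
     LabelBijection S₂ (λ g → NonId g × TwoQubit g) ×
     IsoTo 4 W32Line S₂ CommutingVeldkampLine ×
     MagicSquare S₂ (λ g → NonId g × TwoQubit g × ¬ Removed g)) ×
    (FormsPG 2 S₃ ×
     S₃ (setOf (p0 ∷ p1 ∷ p3 ∷ p5 ∷ p7 ∷ p8 ∷ [])) ×
     S₃ (setOf (p0 ∷ p1 ∷ p3 ∷ p4 ∷ p5 ∷ p7 ∷ p8 ∷ [])) ×
     LabelBijection S₃ (λ g → NonId g × OnlyIY g))
mainTheorem11 =
  ( C₁.formsPG
  , L₁.labelBijection NonId L₁.encode-nonId (λ _ g≢III → g≢III) (λ g _ → encode₁-decode₁ g)
  , λ _ _ _ _ _ _ → veldkampLine-label-product ) ,
  ( C₂.formsPG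
  , L₂.labelBijection (λ g → NonId g × TwoQubit g)
      (λ v v≢0 → L₂.encode-nonId v v≢0 , twoQubit-encode₂ v) (λ _ → proj₁)
      (λ g → encode₂-decode₂ g ∘ proj₂)
  , C₂.isoTo W32Line CommutingVeldkampLine w32Line⇔commutingVeldkampLine
  , magicSquare ) ,
  ( C₃.formsPG
  , from-yes (S₃? (setOf (p0 ∷ p1 ∷ p3 ∷ p5 ∷ p7 ∷ p8 ∷ [])))
  , from-yes (S₃? (setOf (p0 ∷ p1 ∷ p3 ∷ p4 ∷ p5 ∷ p7 ∷ p8 ∷ [])))
  , L₃.labelBijection (λ g → NonId g × OnlyIY g)
      (λ v v≢0 → L₃.encode-nonId v v≢0 , onlyIY-encode₃ v) (λ _ → proj₁)
      (λ g → encode₃-decode₃ g ∘ proj₂) )
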